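{- If $G\in\mathbb{Np}^\infty$ is a Conway game, then $G$ is invertible and its inverse is its conjugate: $G+\overline{G}=0$.
   Context: Affine normal play forms $\mathbb{Np}^\infty$ are defined recursively: two atomic forms $\infty$ and $\overline{\infty}$ with no options; every other form is $G=\{G^{\mathcal L}\mid G^{\mathcal R}\}$ with finite nonempty sets of previously constructed forms as Left and Right options. Followers of $G$: $G$ and followers of its options. Disjunctive sum: $\infty+X=X+\infty=\infty$ for $X\neq\overline{\infty}$; $\overline{\infty}+X=X+\overline{\infty}=\overline{\infty}$ for $X\ne\infty$; $\infty+\overline{\infty}$ undefined; otherwise $G+H=\{G^L+H,G+H^L\mid G^R+H,G+H^R\}$. Outcomes: Left wins $\infty$ and Right wins $\overline{\infty}$ whoever moves; otherwise play alternates, Left moving first wins iff some Left option is won by Left moving second, Left moving second wins iff every Right option is won by Left moving first, symmetrically for Right. $o(G)\in\{\mathscr L,\mathscr N,\mathscr P,\mathscr R\}$ (Left wins either way, first player wins, second player wins, Right wins either way), ordered $\mathscr L>\mathscr N,\mathscr P>\mathscr R$ with $\mathscr N,\mathscr P$ incomparable. $G\succcurlyeq H$ means $o(G+X)\geqslant o(H+X)$ for all $X\in\mathbb{Np}^\infty\setminus\{\infty,\overline\infty\}$; $G=H$ means both $G\succcurlyeq H$ and $H\succcurlyeq G$. $0=\{\overline\infty\mid\infty\}$. $G$ is invertible if there exists $H\in\mathbb{Np}^\infty$ with $G+H=0$. Conjugate $\overline G$: $\overline\infty$ if $G=\infty$, $\infty$ if $G=\overline\infty$, otherwise $\{\overline{G^R}\mid\overline{G^L}\}$.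 A form $G\notin\{\infty,\overline\infty\}$ is a check if $\infty\in G^{\mathcal L}$ or $\overline\infty\in G^{\mathcal R}$. A Conway form is a form $G\notin\{\infty,\overline\infty\}$ none of whose followers is a check; a Conway game is a form equal to some Conway form. -}

module Defs where

open import Data.Nat using (ℕ; zero; suc; _+_)
open import Data.Fin using (Fin; splitAt)
open import Data.Sum using (_⊎_; inj₁; inj₂; [_,_])
open import Data.Product using (Σ; _×_; _,_; ∃)
open import Data.Empty using (⊥)
open import Data.Unit using (⊤)
open import Relation.Nullary using (¬_)
open import Relation.Binary.PropositionalEquality using (_≡_)

-- Affine normal play forms.  A non-atomic form  { G^L | G^R }  is given by a
-- nonempty finite family of Left options (indexed by Fin (suc m)) and a
-- nonempty finite family of Right options (indexed by Fin (suc n)).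
data Form : Set where
  ∞    : Form
  ∞bar : Form
  node : (m : ℕ) → (Fin (suc m) → Form) → (n : ℕ) → (Fin (suc n) → Form) → Form

NonAtomic : Form → Set
NonAtomic ∞ = ⊥
NonAtomic ∞bar = ⊥
NonAtomic (node _ _ _ _) = ⊤

-- The sum  ∞ + ∞bar  (and  ∞bar + ∞) is undefined in the paper.
SumDefined : Form → Form → Set
SumDefined G H = ¬ ((G ≡ ∞ × H ≡ ∞bar) ⊎ (G ≡ ∞bar × H ≡ ∞))

-- On the undefined pairs (∞,∞bar), (∞bar,∞) the value is an
-- arbitrary convention (left argument); it is only ever used under SumDefined
-- or where one summand is non-atomic (in which case all recursive sums are defined).
infixl 6 _⊕_
_⊕_ : Form → Form → Form
∞ ⊕ _ = ∞
∞bar ⊕ _ = ∞bar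
node m L n R ⊕ ∞ = ∞
node m L n R ⊕ ∞bar = ∞bar
node m L n R ⊕ node m' L' n' R' =
  node (m + suc m')
       (λ k → [ (λ i → L i ⊕ node m' L' n' R') , (λ i → node m L n R ⊕ L' i) ] (splitAt (suc m) k))
       (n + suc n')
       (λ k → [ (λ j → R j ⊕ node m' L' n' R') , (λ j → node m L n R ⊕ R' j) ] (splitAt (suc n) k))

mutual
  LeftWinsFirst : Form → Set
  LeftWinsFirst ∞ = ⊤
  LeftWinsFirst ∞bar = ⊥
  LeftWinsFirst (node m L n R) = Σ (Fin (suc m)) (λ i → LeftWinsSecond (L i))

  LeftWinsSecond : Form → Set
  LeftWinsSecond ∞ = ⊤
  LeftWinsSecond ∞bar = ⊥
  LeftWinsSecond (node m L n R) = (j : Fin (suc n)) → LeftWinsFirst (R j)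

mutual
  RightWinsFirst : Form → Set
  RightWinsFirst ∞ = ⊥
  RightWinsFirst ∞bar = ⊤
  RightWinsFirst (node m L n R) = Σ (Fin (suc n)) (λ j → RightWinsSecond (R j))

  RightWinsSecond : Form → Set
  RightWinsSecond ∞ = ⊥
  RightWinsSecond ∞bar = ⊤
  RightWinsSecond (node m L n R) = (i : Fin (suc m)) → RightWinsFirst (L i)

data Outcome : Set where
  𝓛 𝓝 𝓟 𝓡 : Outcome

data HasOutcome (G : Form) : Outcome → Set where
  isL : LeftWinsFirst G → LeftWinsSecond G → HasOutcome G 𝓛
  isN : LeftWinsFirst G → RightWinsFirst G → HasOutcome G 𝓝
  isP : LeftWinsSecond G → RightWinsSecond G → HasOutcome G 𝓟
  isR : RightWinsFirst G → RightWinsSecond G → HasOutcome G 𝓡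

data _≤o_ : Outcome → Outcome → Set where
  ≤o-refl : ∀ {o} → o ≤o o
  𝓡≤ : ∀ {o} → 𝓡 ≤o o
  ≤𝓛 : ∀ {o} → o ≤o 𝓛

_≽_ : Form → Form → Set
G ≽ H = (X : Form) → NonAtomic X →
        ∀ oG oH → HasOutcome (G ⊕ X) oG → HasOutcome (H ⊕ X) oH → oH ≤o oG

_≈g_ : Form → Form → Set
G ≈g H = (G ≽ H) × (H ≽ G)

zeroF : Form
zeroF = node 0 (λ _ → ∞bar) 0 (λ _ → ∞)

Invertible : Form → Set
Invertible G = Σ Form (λ H → SumDefined G H × (G ⊕ H) ≈g zeroF)

conj : Form → Form
conj ∞ = ∞bar
conj ∞bar = ∞
conj (node m L n R) = node n (λ j → conj (R j)) m (λ i → conj (L i))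

IsCheck : Form → Set
IsCheck ∞ = ⊥
IsCheck ∞bar = ⊥
IsCheck (node m L n R) = Σ (Fin (suc m)) (λ i → L i ≡ ∞) ⊎ Σ (Fin (suc n)) (λ j → R j ≡ ∞bar)

data Follower : Form → Form → Set where
  self  : ∀ {G} → Follower G G
  viaL  : ∀ {H m L n R} (i : Fin (suc m)) → Follower H (L i) → Follower H (node m L n R)
  viaR  : ∀ {H m L n R} (j : Fin (suc n)) → Follower H (R j) → Follower H (node m L n R)

ConwayForm : Form → Set
ConwayForm G = NonAtomic G × ((H : Form) → Follower H G → ¬ IsCheck H)

ConwayGame : Form → Set
ConwayGame G = Σ Form (λ K → ConwayForm K × G ≈g K)

{-# OPTIONS --safe #-}
-- Let K be a Conway form, so no follower of K is a check.  In (K + K̄) + X, Left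
-- moving second answers every Right move in K + K̄ by the mirror move in the other
-- copy, and otherwise plays her winning strategy in X.  This only fails if Right can
-- move some copy to ∞bar, i.e. if a follower of K is a check.  With the symmetric
-- argument for Right, (K + K̄) + X has the outcome of X, as does 0 + X.  If G = K then
-- also Ḡ = K̄, and exchanging the summands of (G + Ḡ) + X one at a time shows that it
-- has the outcome of (K + K̄) + X for every non-atomic X, i.e. G + Ḡ = 0.  Atomic forms
-- are not Conway games: a Conway form plus {∞ | ∞} is a Left win, whereas
-- ∞bar + {∞ | ∞} = ∞bar (and ∞ is the conjugate case).
module Submission where

open import Defs
open import Data.Empty using (⊥; ⊥-elim)
open import Data.Fin using (Fin; zero; suc; splitAt; _↑ˡ_; _↑ʳ_)
open import Data.Fin.Properties using (splitAt-↑ˡ; splitAt-↑ʳ)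
open import Data.Nat using (suc)
open import Data.Product using (Σ; _×_; _,_)
open import Data.Sum using (_⊎_; inj₁; inj₂; [_,_]; swap)
open import Data.Unit using (tt)
open import Function using (_∘_)
open import Induction.WellFounded using (Acc; acc; WellFounded)
open import Relation.Binary.Bundles using (Setoid)
open import Relation.Binary.PropositionalEquality using (_≡_; _≢_; refl; sym; cong; subst)
open import Relation.Nullary using (¬_)
import Relation.Binary.Reasoning.Setoid as SetoidReasoning

data Side : Set where
  left right : Side

Options : Side → Form → Set
Options _ ∞ = ⊥
Options _ ∞bar = ⊥
Options left (node m _ _ _) = Fin (suc m)
Options right (node _ _ n _) = Fin (suc n)

option : ∀ s G → Options s G → Form
option left (node _ L _ _) i = L i
option right (node _ _ _ R) j = R j

-- Recursion through option s A i is not structural for an abstract side s, so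
-- recursions over several summands go through well-foundedness of _≺_.
infix 4 _≺_
data _≺_ : Form → Form → Set where
  isOption : ∀ s G (i : Options s G) → option s G i ≺ G

≺-wellFounded : WellFounded _≺_
≺-wellFounded ∞ = acc λ { (isOption _ _ ()) }
≺-wellFounded ∞bar = acc λ { (isOption _ _ ()) }
≺-wellFounded (node m L n R) = acc λ
  { (isOption left _ i) → ≺-wellFounded (L i)
  ; (isOption right _ j) → ≺-wellFounded (R j)
  }

sumDefined-nonAtomicˡ : ∀ {A B} → NonAtomic A → SumDefined A B
sumDefined-nonAtomicˡ nA (inj₁ (refl , _)) = nA
sumDefined-nonAtomicˡ nA (inj₂ (refl , _)) = nA

sumDefined-nonAtomicʳ : ∀ {A B} → NonAtomic B → SumDefined A B
sumDefined-nonAtomicʳ nB (inj₁ (_ , refl)) = nB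
sumDefined-nonAtomicʳ nB (inj₂ (_ , refl)) = nB

⊕-nonAtomic : ∀ A B → NonAtomic A → NonAtomic B → NonAtomic (A ⊕ B)
⊕-nonAtomic (node _ _ _ _) (node _ _ _ _) _ _ = tt

conj-nonAtomic : ∀ A → NonAtomic A → NonAtomic (conj A)
conj-nonAtomic (node _ _ _ _) _ = tt

data SumOption (s : Side) (A B : Form) : Form → Set where
  inˡ : (i : Options s A) → SumOption s A B (option s A i ⊕ B)
  inʳ : (j : Options s B) → SumOption s A B (A ⊕ option s B j)

sumOption : ∀ s A B (k : Options s (A ⊕ B)) → SumOption s A B (option s (A ⊕ B) k)
sumOption left (node m _ _ _) (node _ _ _ _) k with splitAt (suc m) k
... | inj₁ i = inˡ i
... | inj₂ j = inʳ j
sumOption right (node _ _ n _) (node _ _ _ _) k with splitAt (suc n) k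
... | inj₁ i = inˡ i
... | inj₂ j = inʳ j

⊕-optionˡ : ∀ s A B → NonAtomic B → (i : Options s A) → (P : Form → Set) →
            P (option s A i ⊕ B) → Σ (Options s (A ⊕ B)) (P ∘ option s (A ⊕ B))
⊕-optionˡ left A@(node m L _ _) B@(node m' L' _ _) _ i P p =
  i ↑ˡ suc m' ,
  subst P (cong [ (λ x → L x ⊕ B) , (λ x → A ⊕ L' x) ] (sym (splitAt-↑ˡ (suc m) i (suc m')))) p
⊕-optionˡ right A@(node _ _ n R) B@(node _ _ n' R') _ j P p =
  j ↑ˡ suc n' ,
  subst P (cong [ (λ x → R x ⊕ B) , (λ x → A ⊕ R' x) ] (sym (splitAt-↑ˡ (suc n) j (suc n')))) p

⊕-optionʳ : ∀ s A B → NonAtomic A → (j : Options s B) → (P : Form → Set) →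
            P (A ⊕ option s B j) → Σ (Options s (A ⊕ B)) (P ∘ option s (A ⊕ B))
⊕-optionʳ left A@(node m L _ _) B@(node m' L' _ _) _ i P p =
  suc m ↑ʳ i ,
  subst P (cong [ (λ x → L x ⊕ B) , (λ x → A ⊕ L' x) ] (sym (splitAt-↑ʳ (suc m) (suc m') i))) p
⊕-optionʳ right A@(node _ _ n R) B@(node _ _ n' R') _ j P p =
  suc n ↑ʳ j ,
  subst P (cong [ (λ x → R x ⊕ B) , (λ x → A ⊕ R' x) ] (sym (splitAt-↑ʳ (suc n) (suc n') j))) p

-- Bisimilarity: the same game tree up to reindexing (and duplication) of options.
-- Sums are associative and commutative only up to _∼_.
infix 4 _∼_
data _∼_ : Form → Form → Set where
  ∞∼∞ : ∞ ∼ ∞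
  ∞bar∼∞bar : ∞bar ∼ ∞bar
  node∼node : ∀ {m L n R m' L' n' R'} →
    let A = node m L n R ; B = node m' L' n' R' in
    (∀ s i → Σ (Options s B) λ j → option s A i ∼ option s B j) →
    (∀ s j → Σ (Options s A) λ i → option s A i ∼ option s B j) → A ∼ B

∼-pointwise : ∀ {m L L' n R R'} → (∀ i → L i ∼ L' i) → (∀ j → R j ∼ R' j) →
              node m L n R ∼ node m L' n R'
∼-pointwise l r =
  node∼node (λ { left i → i , l i ; right j → j , r j }) (λ { left i → i , l i ; right j → j , r j })

∼-refl : ∀ A → A ∼ A
∼-refl ∞ = ∞∼∞
∼-refl ∞bar = ∞bar∼∞bar
∼-refl (node m L n R) = ∼-pointwise (λ i → ∼-refl (L i)) (λ j → ∼-refl (R j))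

∼-sym : ∀ {A B} → A ∼ B → B ∼ A
∼-sym ∞∼∞ = ∞∼∞
∼-sym ∞bar∼∞bar = ∞bar∼∞bar
∼-sym (node∼node f g) =
  node∼node (λ s j → let (i , p) = g s j in i , ∼-sym p) (λ s i → let (j , p) = f s i in j , ∼-sym p)

∼-trans : ∀ {A B C} → A ∼ B → B ∼ C → A ∼ C
∼-trans ∞∼∞ ∞∼∞ = ∞∼∞
∼-trans ∞bar∼∞bar ∞bar∼∞bar = ∞bar∼∞bar
∼-trans (node∼node f g) (node∼node f' g') =
  node∼node (λ s i → let (j , p) = f s i ; (k , q) = f' s j in k , ∼-trans p q)
            (λ s k → let (j , q) = g' s k ; (i , p) = g s j in i , ∼-trans p q)

mutual
  ∼-lwf : ∀ {A B} → A ∼ B → LeftWinsFirst A → LeftWinsFirst B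
  ∼-lwf ∞∼∞ _ = tt
  ∼-lwf (node∼node f _) (i , p) = let (i' , q) = f left i in i' , ∼-lws q p

  ∼-lws : ∀ {A B} → A ∼ B → LeftWinsSecond A → LeftWinsSecond B
  ∼-lws ∞∼∞ _ = tt
  ∼-lws (node∼node _ g) p j' = let (j , q) = g right j' in ∼-lwf q (p j)

mutual
  ∼-rwf : ∀ {A B} → A ∼ B → RightWinsFirst A → RightWinsFirst B
  ∼-rwf ∞bar∼∞bar _ = tt
  ∼-rwf (node∼node f _) (j , p) = let (j' , q) = f right j in j' , ∼-rws q p

  ∼-rws : ∀ {A B} → A ∼ B → RightWinsSecond A → RightWinsSecond B
  ∼-rws ∞bar∼∞bar _ = tt
  ∼-rws (node∼node _ g) p i' = let (i , q) = g left i' in ∼-rwf q (p i)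

conj-involutive : ∀ A → conj (conj A) ∼ A
conj-involutive ∞ = ∞∼∞
conj-involutive ∞bar = ∞bar∼∞bar
conj-involutive (node m L n R) = ∼-pointwise (λ i → conj-involutive (L i)) (λ j → conj-involutive (R j))

conj-[,] : ∀ {I J : Set} {f : I → Form} {g : J → Form} {f' g'} →
           (∀ i → conj (f i) ∼ f' i) → (∀ j → conj (g j) ∼ g' j) →
           ∀ x → conj ([ f , g ] x) ∼ [ f' , g' ] x
conj-[,] p q (inj₁ i) = p i
conj-[,] p q (inj₂ j) = q j

conj-⊕ : ∀ A B → conj (A ⊕ B) ∼ conj A ⊕ conj B
conj-⊕ ∞ _ = ∞bar∼∞bar
conj-⊕ ∞bar _ = ∞∼∞
conj-⊕ (node _ _ _ _) ∞ = ∞bar∼∞bar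
conj-⊕ (node _ _ _ _) ∞bar = ∞∼∞
conj-⊕ A@(node m L n R) B@(node _ L' _ R') =
  ∼-pointwise (conj-[,] (λ j → conj-⊕ (R j) B) (λ j → conj-⊕ A (R' j)) ∘ splitAt (suc n))
              (conj-[,] (λ i → conj-⊕ (L i) B) (λ i → conj-⊕ A (L' i)) ∘ splitAt (suc m))

⊕-∼-⊕ : ∀ A B C D → NonAtomic A → NonAtomic B → NonAtomic C → NonAtomic D →
        (∀ s i → Σ (Options s (C ⊕ D)) λ k → option s A i ⊕ B ∼ option s (C ⊕ D) k) →
        (∀ s j → Σ (Options s (C ⊕ D)) λ k → A ⊕ option s B j ∼ option s (C ⊕ D) k) →
        (∀ s i → Σ (Options s (A ⊕ B)) λ k → option s (A ⊕ B) k ∼ option s C i ⊕ D) →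
        (∀ s j → Σ (Options s (A ⊕ B)) λ k → option s (A ⊕ B) k ∼ C ⊕ option s D j) →
        A ⊕ B ∼ C ⊕ D
⊕-∼-⊕ A@(node _ _ _ _) B@(node _ _ _ _) C@(node _ _ _ _) D@(node _ _ _ _) _ _ _ _ fA fB gC gD =
  node∼node (λ s k → forward s (sumOption s A B k)) (λ s k → backward s (sumOption s C D k))
  where
  forward : ∀ s {X} → SumOption s A B X → Σ (Options s (C ⊕ D)) λ k → X ∼ option s (C ⊕ D) k
  forward s (inˡ i) = fA s i
  forward s (inʳ j) = fB s j
  backward : ∀ s {X} → SumOption s C D X → Σ (Options s (A ⊕ B)) λ k → option s (A ⊕ B) k ∼ X
  backward s (inˡ i) = gC s i
  backward s (inʳ j) = gD s j

⊕-cong : ∀ {P P' Q Q'} → P ∼ P' → Q ∼ Q' → P ⊕ Q ∼ P' ⊕ Q'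
⊕-cong ∞∼∞ _ = ∞∼∞
⊕-cong ∞bar∼∞bar _ = ∞bar∼∞bar
⊕-cong (node∼node _ _) ∞∼∞ = ∞∼∞
⊕-cong (node∼node _ _) ∞bar∼∞bar = ∞bar∼∞bar
⊕-cong {P} {P'} {Q} {Q'} sP@(node∼node fP gP) sQ@(node∼node fQ gQ) =
  ⊕-∼-⊕ P Q P' Q' tt tt tt tt
    (λ s i → let (i' , p) = fP s i in ⊕-optionˡ s P' Q' tt i' (_ ∼_) (⊕-cong p sQ))
    (λ s j → let (j' , q) = fQ s j in ⊕-optionʳ s P' Q' tt j' (_ ∼_) (⊕-cong sP q))
    (λ s i' → let (i , p) = gP s i' in ⊕-optionˡ s P Q tt i (_∼ _) (⊕-cong p sQ))
    (λ s j' → let (j , q) = gQ s j' in ⊕-optionʳ s P Q tt j (_∼ _) (⊕-cong sP q))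

⊕-comm : ∀ A B → SumDefined A B → A ⊕ B ∼ B ⊕ A
⊕-comm A B = go A B (≺-wellFounded A) (≺-wellFounded B)
  where
  go : ∀ A B → Acc _≺_ A → Acc _≺_ B → SumDefined A B → A ⊕ B ∼ B ⊕ A
  go ∞ ∞ _ _ _ = ∞∼∞
  go ∞ ∞bar _ _ d = ⊥-elim (d (inj₁ (refl , refl)))
  go ∞ (node _ _ _ _) _ _ _ = ∞∼∞
  go ∞bar ∞ _ _ d = ⊥-elim (d (inj₂ (refl , refl)))
  go ∞bar ∞bar _ _ _ = ∞bar∼∞bar
  go ∞bar (node _ _ _ _) _ _ _ = ∞bar∼∞bar
  go (node _ _ _ _) ∞ _ _ _ = ∞∼∞
  go (node _ _ _ _) ∞bar _ _ _ = ∞bar∼∞bar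
  go A@(node _ _ _ _) B@(node _ _ _ _) a@(acc rsA) b@(acc rsB) _ =
    ⊕-∼-⊕ A B B A tt tt tt tt
      (λ s i → ⊕-optionʳ s B A tt i (_ ∼_) (optionA s i))
      (λ s j → ⊕-optionˡ s B A tt j (_ ∼_) (optionB s j))
      (λ s j → ⊕-optionʳ s A B tt j (_∼ _) (optionB s j))
      (λ s i → ⊕-optionˡ s A B tt i (_∼ _) (optionA s i))
    where
    optionA : ∀ s i → option s A i ⊕ B ∼ B ⊕ option s A i
    optionA s i = go (option s A i) B (rsA (isOption s A i)) b (sumDefined-nonAtomicʳ tt)
    optionB : ∀ s j → A ⊕ option s B j ∼ option s B j ⊕ A
    optionB s j = go A (option s B j) a (rsB (isOption s B j)) (sumDefined-nonAtomicˡ tt)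

⊕-assoc : ∀ A B C → (A ⊕ B) ⊕ C ∼ A ⊕ (B ⊕ C)
⊕-assoc A B C = go A B C (≺-wellFounded A) (≺-wellFounded B) (≺-wellFounded C)
  where
  go : ∀ A B C → Acc _≺_ A → Acc _≺_ B → Acc _≺_ C → (A ⊕ B) ⊕ C ∼ A ⊕ (B ⊕ C)
  go ∞ _ _ _ _ _ = ∞∼∞
  go ∞bar _ _ _ _ _ = ∞bar∼∞bar
  go (node _ _ _ _) ∞ _ _ _ _ = ∞∼∞
  go (node _ _ _ _) ∞bar _ _ _ _ = ∞bar∼∞bar
  go (node _ _ _ _) (node _ _ _ _) ∞ _ _ _ = ∞∼∞
  go (node _ _ _ _) (node _ _ _ _) ∞bar _ _ _ = ∞bar∼∞bar
  go A@(node _ _ _ _) B@(node _ _ _ _) C@(node _ _ _ _) a@(acc rsA) b@(acc rsB) c@(acc rsC) =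
    ⊕-∼-⊕ (A ⊕ B) C A (B ⊕ C) tt tt tt tt
      (λ s k → fromAB s (sumOption s A B k))
      fromC
      toA
      (λ s k → toBC s (sumOption s B C k))
    where
    optionA : ∀ s i → (option s A i ⊕ B) ⊕ C ∼ option s A i ⊕ (B ⊕ C)
    optionA s i = go (option s A i) B C (rsA (isOption s A i)) b c
    optionB : ∀ s j → (A ⊕ option s B j) ⊕ C ∼ A ⊕ (option s B j ⊕ C)
    optionB s j = go A (option s B j) C a (rsB (isOption s B j)) c
    optionC : ∀ s l → (A ⊕ B) ⊕ option s C l ∼ A ⊕ (B ⊕ option s C l)
    optionC s l = go A B (option s C l) a b (rsC (isOption s C l))

    fromAB : ∀ s {X} → SumOption s A B X → Σ (Options s (A ⊕ (B ⊕ C))) λ k → X ⊕ C ∼ option s (A ⊕ (B ⊕ C)) k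
    fromAB s (inˡ i) = ⊕-optionˡ s A (B ⊕ C) tt i (_ ∼_) (optionA s i)
    fromAB s (inʳ j) =
      let (k , p) = ⊕-optionˡ s B C tt j (λ Y → (A ⊕ option s B j) ⊕ C ∼ A ⊕ Y) (optionB s j)
      in ⊕-optionʳ s A (B ⊕ C) tt k (_ ∼_) p
    fromC : ∀ s l → Σ (Options s (A ⊕ (B ⊕ C))) λ k → (A ⊕ B) ⊕ option s C l ∼ option s (A ⊕ (B ⊕ C)) k
    fromC s l =
      let (k , p) = ⊕-optionʳ s B C tt l (λ Y → (A ⊕ B) ⊕ option s C l ∼ A ⊕ Y) (optionC s l)
      in ⊕-optionʳ s A (B ⊕ C) tt k (_ ∼_) p

    toA : ∀ s i → Σ (Options s ((A ⊕ B) ⊕ C)) λ k → option s ((A ⊕ B) ⊕ C) k ∼ option s A i ⊕ (B ⊕ C)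
    toA s i =
      let (k , p) = ⊕-optionˡ s A B tt i (λ Y → Y ⊕ C ∼ option s A i ⊕ (B ⊕ C)) (optionA s i)
      in ⊕-optionˡ s (A ⊕ B) C tt k (_∼ _) p

    toBC : ∀ s {X} → SumOption s B C X → Σ (Options s ((A ⊕ B) ⊕ C)) λ k → option s ((A ⊕ B) ⊕ C) k ∼ A ⊕ X
    toBC s (inˡ j) =
      let (k , p) = ⊕-optionʳ s A B tt j (λ Y → Y ⊕ C ∼ A ⊕ (option s B j ⊕ C)) (optionB s j)
      in ⊕-optionˡ s (A ⊕ B) C tt k (_∼ _) p
    toBC s (inʳ l) = ⊕-optionʳ s (A ⊕ B) C tt l (_∼ _) (optionC s l)

⊕-exchange : ∀ A B C → SumDefined A B → A ⊕ (B ⊕ C) ∼ B ⊕ (A ⊕ C)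
⊕-exchange A B C d =
  ∼-trans (∼-sym (⊕-assoc A B C)) (∼-trans (⊕-cong (⊕-comm A B d) (∼-refl C)) (⊕-assoc B A C))

lwf-⊕ˡ : ∀ A B → NonAtomic B → (i : Options left A) →
         LeftWinsSecond (option left A i ⊕ B) → LeftWinsFirst (A ⊕ B)
lwf-⊕ˡ A@(node _ _ _ _) B@(node _ _ _ _) _ i = ⊕-optionˡ left A B tt i LeftWinsSecond

lwf-⊕ʳ : ∀ A B → NonAtomic A → (j : Options left B) →
         LeftWinsSecond (A ⊕ option left B j) → LeftWinsFirst (A ⊕ B)
lwf-⊕ʳ A@(node _ _ _ _) B@(node _ _ _ _) _ j = ⊕-optionʳ left A B tt j LeftWinsSecond

lws-⊕ : ∀ A B → NonAtomic A → NonAtomic B →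
        (∀ j → LeftWinsFirst (option right A j ⊕ B)) →
        (∀ j → LeftWinsFirst (A ⊕ option right B j)) → LeftWinsSecond (A ⊕ B)
lws-⊕ A@(node _ _ _ _) B@(node _ _ _ _) _ _ f g k = answer (sumOption right A B k)
  where
  answer : ∀ {Y} → SumOption right A B Y → LeftWinsFirst Y
  answer (inˡ j) = f j
  answer (inʳ j) = g j

mutual
  lwf-conj⇒rwf : ∀ A → LeftWinsFirst (conj A) → RightWinsFirst A
  lwf-conj⇒rwf ∞bar _ = tt
  lwf-conj⇒rwf (node _ _ _ R) (j , p) = j , lws-conj⇒rws (R j) p

  lws-conj⇒rws : ∀ A → LeftWinsSecond (conj A) → RightWinsSecond A
  lws-conj⇒rws ∞bar _ = tt
  lws-conj⇒rws (node _ L _ _) p i = lwf-conj⇒rwf (L i) (p i)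

mutual
  rwf-conj⇒lwf : ∀ A → RightWinsFirst (conj A) → LeftWinsFirst A
  rwf-conj⇒lwf ∞ _ = tt
  rwf-conj⇒lwf (node _ L _ _) (i , p) = i , rws-conj⇒lws (L i) p

  rws-conj⇒lws : ∀ A → RightWinsSecond (conj A) → LeftWinsSecond A
  rws-conj⇒lws ∞ _ = tt
  rws-conj⇒lws (node _ _ _ R) p j = rwf-conj⇒lwf (R j) (p j)

rwf⇒lwf-conj : ∀ A → RightWinsFirst A → LeftWinsFirst (conj A)
rwf⇒lwf-conj A = rwf-conj⇒lwf (conj A) ∘ ∼-rwf (∼-sym (conj-involutive A))

rws⇒lws-conj : ∀ A → RightWinsSecond A → LeftWinsSecond (conj A)
rws⇒lws-conj A = rws-conj⇒lws (conj A) ∘ ∼-rws (∼-sym (conj-involutive A))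

∃-or-∀ : ∀ k {P Q : Fin k → Set} → (∀ i → P i ⊎ Q i) → Σ (Fin k) P ⊎ (∀ i → Q i)
∃-or-∀ 0 h = inj₂ λ ()
∃-or-∀ (suc k) h with h zero | ∃-or-∀ k (h ∘ suc)
... | inj₁ p | _ = inj₁ (zero , p)
... | inj₂ _ | inj₁ (i , p) = inj₁ (suc i , p)
... | inj₂ q | inj₂ qs = inj₂ λ { zero → q ; (suc i) → qs i }

mutual
  lwf⊎rws : ∀ G → LeftWinsFirst G ⊎ RightWinsSecond G
  lwf⊎rws ∞ = inj₁ tt
  lwf⊎rws ∞bar = inj₂ tt
  lwf⊎rws (node m L _ _) = ∃-or-∀ (suc m) (λ i → lws⊎rwf (L i))

  lws⊎rwf : ∀ G → LeftWinsSecond G ⊎ RightWinsFirst G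
  lws⊎rwf ∞ = inj₁ tt
  lws⊎rwf ∞bar = inj₂ tt
  lws⊎rwf (node _ _ n R) = swap (∃-or-∀ (suc n) (λ j → swap (lwf⊎rws (R j))))

mutual
  lwf⇒¬rws : ∀ G → LeftWinsFirst G → ¬ RightWinsSecond G
  lwf⇒¬rws (node _ L _ _) (i , p) q = lws⇒¬rwf (L i) p (q i)

  lws⇒¬rwf : ∀ G → LeftWinsSecond G → ¬ RightWinsFirst G
  lws⇒¬rwf (node _ _ _ R) p (j , q) = lwf⇒¬rws (R j) (p j) q

outcome : ∀ G → Σ Outcome (HasOutcome G)
outcome G with lwf⊎rws G | lws⊎rwf G
... | inj₁ a | inj₁ b = 𝓛 , isL a b
... | inj₁ a | inj₂ b = 𝓝 , isN a b
... | inj₂ a | inj₁ b = 𝓟 , isP b a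
... | inj₂ a | inj₂ b = 𝓡 , isR b a

outcome-unique : ∀ {G o o'} → HasOutcome G o → HasOutcome G o' → o ≡ o'
outcome-unique (isL _ _) (isL _ _) = refl
outcome-unique (isN _ _) (isN _ _) = refl
outcome-unique (isP _ _) (isP _ _) = refl
outcome-unique (isR _ _) (isR _ _) = refl
outcome-unique {G} (isL _ b) (isN _ d) = ⊥-elim (lws⇒¬rwf G b d)
outcome-unique {G} (isL a _) (isP _ d) = ⊥-elim (lwf⇒¬rws G a d)
outcome-unique {G} (isL a _) (isR _ d) = ⊥-elim (lwf⇒¬rws G a d)
outcome-unique {G} (isN _ b) (isL _ d) = ⊥-elim (lws⇒¬rwf G d b)
outcome-unique {G} (isN a _) (isP _ d) = ⊥-elim (lwf⇒¬rws G a d)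
outcome-unique {G} (isN a _) (isR _ d) = ⊥-elim (lwf⇒¬rws G a d)
outcome-unique {G} (isP _ b) (isL c _) = ⊥-elim (lwf⇒¬rws G c b)
outcome-unique {G} (isP _ b) (isN c _) = ⊥-elim (lwf⇒¬rws G c b)
outcome-unique {G} (isP a _) (isR c _) = ⊥-elim (lws⇒¬rwf G a c)
outcome-unique {G} (isR _ b) (isL c _) = ⊥-elim (lwf⇒¬rws G c b)
outcome-unique {G} (isR _ b) (isN c _) = ⊥-elim (lwf⇒¬rws G c b)
outcome-unique {G} (isR a _) (isP c _) = ⊥-elim (lws⇒¬rwf G c a)

≤o-reflexive : ∀ {a b} → a ≡ b → a ≤o b
≤o-reflexive refl = ≤o-refl

≤o-antisym : ∀ {a b} → a ≤o b → b ≤o a → a ≡ b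
≤o-antisym ≤o-refl _ = refl
≤o-antisym 𝓡≤ ≤o-refl = refl
≤o-antisym 𝓡≤ 𝓡≤ = refl
≤o-antisym ≤𝓛 ≤o-refl = refl
≤o-antisym ≤𝓛 ≤𝓛 = refl

infix 4 _≈ₒ_
_≈ₒ_ : Form → Form → Set
A ≈ₒ B = ∀ {o} → HasOutcome A o → HasOutcome B o

≈ₒ-sym : ∀ {A B} → A ≈ₒ B → B ≈ₒ A
≈ₒ-sym {A} A≈B hB = let (o , hA) = outcome A in subst (HasOutcome A) (outcome-unique (A≈B hA) hB) hA

≈ₒ-setoid : Setoid _ _
≈ₒ-setoid = record
  { Carrier = Form
  ; _≈_ = _≈ₒ_
  ; isEquivalence = record { refl = λ h → h ; sym = ≈ₒ-sym ; trans = λ A≈B B≈C → B≈C ∘ A≈B }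
  }

≈ₒ-intro : ∀ {A B} →
  (LeftWinsFirst A → LeftWinsFirst B) → (LeftWinsSecond A → LeftWinsSecond B) →
  (RightWinsFirst A → RightWinsFirst B) → (RightWinsSecond A → RightWinsSecond B) → A ≈ₒ B
≈ₒ-intro lf ls rf rs (isL a b) = isL (lf a) (ls b)
≈ₒ-intro lf ls rf rs (isN a b) = isN (lf a) (rf b)
≈ₒ-intro lf ls rf rs (isP a b) = isP (ls a) (rs b)
≈ₒ-intro lf ls rf rs (isR a b) = isR (rf a) (rs b)

∼⇒≈ₒ : ∀ {A B} → A ∼ B → A ≈ₒ B
∼⇒≈ₒ A∼B = ≈ₒ-intro (∼-lwf A∼B) (∼-lws A∼B) (∼-rwf A∼B) (∼-rws A∼B)

conjₒ : Outcome → Outcome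
conjₒ 𝓛 = 𝓡
conjₒ 𝓝 = 𝓝
conjₒ 𝓟 = 𝓟
conjₒ 𝓡 = 𝓛

conjₒ-involutive : ∀ o → conjₒ (conjₒ o) ≡ o
conjₒ-involutive 𝓛 = refl
conjₒ-involutive 𝓝 = refl
conjₒ-involutive 𝓟 = refl
conjₒ-involutive 𝓡 = refl

outcome-conj⁻ : ∀ A {o} → HasOutcome (conj A) o → HasOutcome A (conjₒ o)
outcome-conj⁻ A (isL a b) = isR (lwf-conj⇒rwf A a) (lws-conj⇒rws A b)
outcome-conj⁻ A (isN a b) = isN (rwf-conj⇒lwf A b) (lwf-conj⇒rwf A a)
outcome-conj⁻ A (isP a b) = isP (rws-conj⇒lws A b) (lws-conj⇒rws A a)
outcome-conj⁻ A (isR a b) = isL (rwf-conj⇒lwf A a) (rws-conj⇒lws A b)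

outcome-conj : ∀ A {o} → HasOutcome A o → HasOutcome (conj A) (conjₒ o)
outcome-conj A = outcome-conj⁻ (conj A) ∘ ∼⇒≈ₒ (∼-sym (conj-involutive A))

conj-≈ₒ : ∀ {A B} → A ≈ₒ B → conj A ≈ₒ conj B
conj-≈ₒ {A} {B} A≈B {o} h =
  subst (HasOutcome (conj B)) (conjₒ-involutive o) (outcome-conj B (A≈B (outcome-conj⁻ A h)))

mutual
  lwf-zero-⊕ : ∀ X → LeftWinsFirst X → LeftWinsFirst (zeroF ⊕ X)
  lwf-zero-⊕ ∞ _ = tt
  lwf-zero-⊕ (node _ L _ _) (i , p) = suc i , lws-zero-⊕ (L i) p

  lws-zero-⊕ : ∀ X → LeftWinsSecond X → LeftWinsSecond (zeroF ⊕ X)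
  lws-zero-⊕ ∞ _ = tt
  lws-zero-⊕ (node _ _ _ _) _ zero = tt
  lws-zero-⊕ (node _ _ _ R) p (suc j) = lwf-zero-⊕ (R j) (p j)

mutual
  rwf-zero-⊕ : ∀ X → RightWinsFirst X → RightWinsFirst (zeroF ⊕ X)
  rwf-zero-⊕ ∞bar _ = tt
  rwf-zero-⊕ (node _ _ _ R) (j , p) = suc j , rws-zero-⊕ (R j) p

  rws-zero-⊕ : ∀ X → RightWinsSecond X → RightWinsSecond (zeroF ⊕ X)
  rws-zero-⊕ ∞bar _ = tt
  rws-zero-⊕ (node _ _ _ _) _ zero = tt
  rws-zero-⊕ (node _ L _ _) p (suc i) = rwf-zero-⊕ (L i) (p i)

zeroF-⊕ : ∀ X → zeroF ⊕ X ≈ₒ X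
zeroF-⊕ X = ≈ₒ-sym (≈ₒ-intro (lwf-zero-⊕ X) (lws-zero-⊕ X) (rwf-zero-⊕ X) (rws-zero-⊕ X))

≈g⇒≈ₒ : ∀ {G H} → G ≈g H → ∀ X → NonAtomic X → G ⊕ X ≈ₒ H ⊕ X
≈g⇒≈ₒ {H = H} (G≽H , H≽G) X nX {o} hG =
  let (o' , hH) = outcome (H ⊕ X)
  in subst (HasOutcome (H ⊕ X)) (≤o-antisym (G≽H X nX o o' hG hH) (H≽G X nX o' o hH hG)) hH

≈ₒ⇒≈g : ∀ {G H} → (∀ X → NonAtomic X → G ⊕ X ≈ₒ H ⊕ X) → G ≈g H
≈ₒ⇒≈g G≈H =
  (λ X nX _ _ hG hH → ≤o-reflexive (outcome-unique hH (G≈H X nX hG))) ,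
  (λ X nX _ _ hH hG → ≤o-reflexive (outcome-unique hG (≈ₒ-sym (G≈H X nX) hH)))

conj-≈g : ∀ {G H} → G ≈g H → conj G ≈g conj H
conj-≈g {G} {H} G≈H = ≈ₒ⇒≈g λ X nX →
  begin
    conj G ⊕ X                ≈⟨ ∼⇒≈ₒ (⊕-cong (∼-refl (conj G)) (conj-involutive X)) ⟨
    conj G ⊕ conj (conj X)    ≈⟨ ∼⇒≈ₒ (conj-⊕ G (conj X)) ⟨
    conj (G ⊕ conj X)         ≈⟨ conj-≈ₒ (≈g⇒≈ₒ G≈H (conj X) (conj-nonAtomic X nX)) ⟩
    conj (H ⊕ conj X)         ≈⟨ ∼⇒≈ₒ (conj-⊕ H (conj X)) ⟩
    conj H ⊕ conj (conj X)    ≈⟨ ∼⇒≈ₒ (⊕-cong (∼-refl (conj H)) (conj-involutive X)) ⟩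
    conj H ⊕ X                ∎
  where open SetoidReasoning ≈ₒ-setoid

CheckFree : Form → Set
CheckFree G = ∀ H → Follower H G → ¬ IsCheck H

conj≡∞⇒≡∞bar : ∀ {Z} → conj Z ≡ ∞ → Z ≡ ∞bar
conj≡∞⇒≡∞bar {∞bar} refl = refl

conj≡∞bar⇒≡∞ : ∀ {Z} → conj Z ≡ ∞bar → Z ≡ ∞
conj≡∞bar⇒≡∞ {∞} refl = refl

checkFree-conj : ∀ K → CheckFree K → CheckFree (conj K)
checkFree-conj ∞ _ _ self ()
checkFree-conj ∞bar _ _ self ()
checkFree-conj K@(node _ _ _ _) cf _ self (inj₁ (j , e)) = cf K self (inj₂ (j , conj≡∞⇒≡∞bar e))
checkFree-conj K@(node _ _ _ _) cf _ self (inj₂ (i , e)) = cf K self (inj₁ (i , conj≡∞bar⇒≡∞ e))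
checkFree-conj (node _ _ _ R) cf H (viaL j f) = checkFree-conj (R j) (λ H' f' → cf H' (viaR j f')) H f
checkFree-conj (node _ L _ _) cf H (viaR i f) = checkFree-conj (L i) (λ H' f' → cf H' (viaL i f')) H f

conwayForm-conj : ∀ K → ConwayForm K → ConwayForm (conj K)
conwayForm-conj K (nK , cf) = conj-nonAtomic K nK , checkFree-conj K cf

-- Right has just moved one copy to Z (resp. conj Z); Left answers by moving the other
-- copy P to conj Z (resp. Z).
mirror-answerʳ : ∀ Z P X → NonAtomic X → Z ≢ ∞bar → (j : Options left P) → option left P j ≡ conj Z →
                 (NonAtomic Z → LeftWinsSecond ((Z ⊕ conj Z) ⊕ X)) → LeftWinsFirst ((Z ⊕ P) ⊕ X)
mirror-answerʳ ∞ _ _ _ _ _ _ _ = tt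
mirror-answerʳ ∞bar _ _ _ Z≢∞bar _ _ _ = ⊥-elim (Z≢∞bar refl)
mirror-answerʳ Z@(node _ _ _ _) P X nX _ j e ih =
  let (k , p) = ⊕-optionʳ left Z P tt j (λ Y → LeftWinsSecond (Y ⊕ X))
                  (subst (λ Y → LeftWinsSecond ((Z ⊕ Y) ⊕ X)) (sym e) (ih tt))
  in lwf-⊕ˡ (Z ⊕ P) X nX k p

mirror-answerˡ : ∀ Z P X → NonAtomic P → NonAtomic X → Z ≢ ∞ → (i : Options left P) → option left P i ≡ Z →
                 (NonAtomic Z → LeftWinsSecond ((Z ⊕ conj Z) ⊕ X)) → LeftWinsFirst ((P ⊕ conj Z) ⊕ X)
mirror-answerˡ ∞ _ _ _ _ Z≢∞ _ _ _ = ⊥-elim (Z≢∞ refl)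
mirror-answerˡ ∞bar (node _ _ _ _) _ _ _ _ _ _ _ = tt
mirror-answerˡ Z@(node _ _ _ _) P X _ nX _ i e ih =
  let (k , p) = ⊕-optionˡ left P (conj Z) tt i (λ Y → LeftWinsSecond (Y ⊕ X))
                  (subst (λ Y → LeftWinsSecond ((Y ⊕ conj Z) ⊕ X)) (sym e) (ih tt))
  in lwf-⊕ˡ (P ⊕ conj Z) X nX k p

mutual
  mirror-lws : ∀ K X → ConwayForm K → LeftWinsSecond X → LeftWinsSecond ((K ⊕ conj K) ⊕ X)
  mirror-lws (node _ _ _ _) ∞ _ _ = tt
  mirror-lws K@(node _ L _ R) X@(node _ _ _ RX) (_ , cf) p =
    lws-⊕ (K ⊕ conj K) X tt tt (λ k → answer (sumOption right K (conj K) k))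
      (λ j → mirror-lwf K (RX j) (tt , cf) (p j))
    where
    answer : ∀ {Y} → SumOption right K (conj K) Y → LeftWinsFirst (Y ⊕ X)
    answer (inˡ j) = mirror-answerʳ (R j) (conj K) X tt (λ e → cf K self (inj₂ (j , e))) j refl
                       (λ nZ → mirror-lws (R j) X (nZ , λ H f → cf H (viaR j f)) p)
    answer (inʳ i) = mirror-answerˡ (L i) K X tt tt (λ e → cf K self (inj₁ (i , e))) i refl
                       (λ nZ → mirror-lws (L i) X (nZ , λ H f → cf H (viaL i f)) p)

  mirror-lwf : ∀ K X → ConwayForm K → LeftWinsFirst X → LeftWinsFirst ((K ⊕ conj K) ⊕ X)
  mirror-lwf (node _ _ _ _) ∞ _ _ = tt
  mirror-lwf K@(node _ _ _ _) X@(node _ LX _ _) cK (i , p) =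
    lwf-⊕ʳ (K ⊕ conj K) X tt i (mirror-lws K (LX i) cK p)

conj-mirror : ∀ K X → conj ((K ⊕ conj K) ⊕ X) ∼ (conj K ⊕ conj (conj K)) ⊕ conj X
conj-mirror K X = ∼-trans (conj-⊕ (K ⊕ conj K) X) (⊕-cong (conj-⊕ K (conj K)) (∼-refl (conj X)))

-- Right's half of the mirror argument is Left's half for the Conway form conj K.
mirror-rws : ∀ K X → ConwayForm K → RightWinsSecond X → RightWinsSecond ((K ⊕ conj K) ⊕ X)
mirror-rws K X cK =
  lws-conj⇒rws ((K ⊕ conj K) ⊕ X) ∘ ∼-lws (∼-sym (conj-mirror K X)) ∘
  mirror-lws (conj K) (conj X) (conwayForm-conj K cK) ∘ rws⇒lws-conj X

mirror-rwf : ∀ K X → ConwayForm K → RightWinsFirst X → RightWinsFirst ((K ⊕ conj K) ⊕ X)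
mirror-rwf K X cK =
  lwf-conj⇒rwf ((K ⊕ conj K) ⊕ X) ∘ ∼-lwf (∼-sym (conj-mirror K X)) ∘
  mirror-lwf (conj K) (conj X) (conwayForm-conj K cK) ∘ rwf⇒lwf-conj X

mirror : ∀ K X → ConwayForm K → (K ⊕ conj K) ⊕ X ≈ₒ X
mirror K X cK = ≈ₒ-sym (≈ₒ-intro (mirror-lwf K X cK) (mirror-lws K X cK) (mirror-rwf K X cK) (mirror-rws K X cK))

∞∣∞ : Form
∞∣∞ = node 0 (λ _ → ∞) 0 (λ _ → ∞)

lwf-⊕-∞∣∞ : ∀ Z → Z ≢ ∞bar → LeftWinsFirst (Z ⊕ ∞∣∞)
lwf-⊕-∞∣∞ ∞ _ = tt
lwf-⊕-∞∣∞ ∞bar Z≢∞bar = ⊥-elim (Z≢∞bar refl)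
lwf-⊕-∞∣∞ Z@(node _ _ _ _) _ = lwf-⊕ʳ Z ∞∣∞ tt zero tt

conwayForm-⊕-∞∣∞ : ∀ K → ConwayForm K → HasOutcome (K ⊕ ∞∣∞) 𝓛
conwayForm-⊕-∞∣∞ K@(node _ _ _ R) (_ , cf) =
  isL (lwf-⊕-∞∣∞ K λ ())
      (lws-⊕ K ∞∣∞ tt tt (λ j → lwf-⊕-∞∣∞ (R j) λ e → cf K self (inj₂ (j , e))) (λ _ → tt))

∞bar≉conwayForm : ∀ K → ConwayForm K → ¬ (∞bar ≈g K)
∞bar≉conwayForm K cK (∞bar≽K , _) with ∞bar≽K ∞∣∞ tt 𝓡 𝓛 (isR tt tt) (conwayForm-⊕-∞∣∞ K cK)
... | ()

conwayGame-nonAtomic : ∀ G → ConwayGame G → NonAtomic G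
conwayGame-nonAtomic ∞ (K , cK , ∞≈K) = ∞bar≉conwayForm (conj K) (conwayForm-conj K cK) (conj-≈g {∞} ∞≈K)
conwayGame-nonAtomic ∞bar (K , cK , ∞bar≈K) = ∞bar≉conwayForm K cK ∞bar≈K
conwayGame-nonAtomic (node _ _ _ _) _ = tt

theorem2p11 : (G : Form) → ConwayGame G →
    Invertible G × SumDefined G (conj G) × (G ⊕ conj G) ≈g zeroF
theorem2p11 G isConway@(K , cK@(nK , _) , G≈K) = (conj G , defined , inverse) , defined , inverse
  where
  nG : NonAtomic G
  nG = conwayGame-nonAtomic G isConway

  defined : SumDefined G (conj G)
  defined = sumDefined-nonAtomicˡ nG

  inverse : (G ⊕ conj G) ≈g zeroF
  inverse = ≈ₒ⇒≈g λ X nX →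
    begin
      (G ⊕ conj G) ⊕ X   ≈⟨ ∼⇒≈ₒ (⊕-assoc G (conj G) X) ⟩
      G ⊕ (conj G ⊕ X)   ≈⟨ ≈g⇒≈ₒ G≈K (conj G ⊕ X) (⊕-nonAtomic (conj G) X (conj-nonAtomic G nG) nX) ⟩
      K ⊕ (conj G ⊕ X)   ≈⟨ ∼⇒≈ₒ (⊕-exchange K (conj G) X (sumDefined-nonAtomicˡ nK)) ⟩
      conj G ⊕ (K ⊕ X)   ≈⟨ ≈g⇒≈ₒ (conj-≈g G≈K) (K ⊕ X) (⊕-nonAtomic K X nK nX) ⟩
      conj K ⊕ (K ⊕ X)   ≈⟨ ∼⇒≈ₒ (⊕-exchange (conj K) K X (sumDefined-nonAtomicʳ nK)) ⟩
      K ⊕ (conj K ⊕ X)   ≈⟨ ∼⇒≈ₒ (⊕-assoc K (conj K) X) ⟨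
      (K ⊕ conj K) ⊕ X   ≈⟨ mirror K X cK ⟩
      X                  ≈⟨ zeroF-⊕ X ⟨
      zeroF ⊕ X          ∎
    where open SetoidReasoning ≈ₒ-setoid
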